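{- Let $n\ge 2$, $\pi\in M_{2n}$, and let $(p,p+1)$ be a non-universal pointer of $\pi$ (indices modulo $2n-1$). Then either $(p-1,p)$ or $(p+1,p+2)$ is non-universal.
   Context: Pointers: for $\pi\in S_N$ written $[\pi(1)\ \cdots\ \pi(N)]$, entry $k$ has left pointer $(k-1,k)$ and right pointer $(k,k+1)$; the pointer word $W(\pi)$ lists $L(\pi(1))R(\pi(1))\cdots L(\pi(N))R(\pi(N))$ with $(0,1)$ and $(N,N+1)$ removed. Two distinct pointers are compatible if their occurrences in $W(\pi)$ interleave ($p\ldots q\ldots p\ldots q$ or $q\ldots p\ldots q\ldots p$); a pointer is universal if it is compatible with every other pointer. Strategic pile: with $X_N=(0\ 1\ \cdots\ N)$, $Y_\pi=(\pi(N)\ \cdots\ \pi(1)\ 0)$ in cycle notation and $C_\pi=Y_\pi\circ X_N$, $\mathrm{SP}(\pi)$ is the set of numbers after $N$ and before $0$ in the cycle of $C_\pi$ containing $0$ and $N$. $\pi\in S_{2n}$ has maximal strategic pile if $|\mathrm{SP}(\pi)|=2n-1$; then $2n$ is immediately followed by $1$, and its contraction is the permutation of $\mathbb Z_{2n-1}$ obtained by deleting the entry $2n$; its pointers are $(p,p+1)$, $p\in\mathbb Z_{2n-1}$, where $(2n-1,1)$ stands for the pointer $(2n-1,2n)$ of the uncontracted permutation, and compatibility is that of the uncontracted permutation. $M_{2n}$ is the set of all such contractions. -}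

module Defs where

open import Data.Nat using (ℕ; zero; suc; _+_; _*_; _∸_; _≤_; _<_; _≡ᵇ_)
open import Data.Bool using (Bool; true; false; if_then_else_)
open import Data.List using (List; []; _∷_; _++_; map; upTo; reverse; length; [_])
open import Data.List.Relation.Binary.Permutation.Propositional using (_↭_)
open import Data.Product using (Σ; ∃; _×_; _,_)
open import Data.Sum using (_⊎_)
open import Relation.Binary.PropositionalEquality using (_≡_; _≢_)

-- A permutation π ∈ S_N in one-line notation [π(1) ⋯ π(N)]:
-- a list that is a rearrangement of [1, 2, …, N].
IsPerm : ℕ → List ℕ → Set
IsPerm N π = π ↭ map suc (upTo N)

-- Cycle notation: the cycle (a₁ a₂ ⋯ aₘ) maps aᵢ ↦ aᵢ₊₁, aₘ ↦ a₁,
-- and fixes everything else.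
cycleApply : List ℕ → ℕ → ℕ
cycleApply [] x = x
cycleApply (a ∷ l) x = go (a ∷ l)
  where
    go : List ℕ → ℕ
    go [] = x
    go (b ∷ []) = if b ≡ᵇ x then a else x
    go (b ∷ c ∷ r) = if b ≡ᵇ x then c else go (c ∷ r)

X : ℕ → ℕ → ℕ
X N = cycleApply (upTo (suc N))

Y : List ℕ → ℕ → ℕ
Y π = cycleApply (reverse π ++ [ 0 ])

C : ℕ → List ℕ → ℕ → ℕ
C N π x = Y π (X N x)

walkTo0 : ℕ → (ℕ → ℕ) → ℕ → List ℕ
walkTo0 zero f x = []
walkTo0 (suc k) f x = if x ≡ᵇ 0 then [] else x ∷ walkTo0 k f (f x)

-- SP(π): the numbers after N and before 0 in the cycle of C_π through N,
-- listed in cycle order.  The fuel N+1 exceeds the length of any cycle on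
-- {0,…,N}; if 0 is not in the cycle of N the list has length N+1.
SP : ℕ → List ℕ → List ℕ
SP N π = walkTo0 (suc N) (C N π) (C N π N)

MaxSP : ℕ → List ℕ → Set
MaxSP n π = length (SP (2 * n) π) ≡ 2 * n ∸ 1

-- Pointers (a, a+1) are encoded by their lower end a.
-- Pointer word W(π) = L(π(1)) R(π(1)) ⋯ L(π(N)) R(π(N)) with (0,1) and
-- (N,N+1) removed; L(k) = (k-1,k), R(k) = (k,k+1).
W : ℕ → List ℕ → List ℕ
W N [] = []
W N (k ∷ π) =
  (if k ≡ᵇ 1 then [] else [ k ∸ 1 ]) ++
  (if k ≡ᵇ N then [] else [ k ]) ++ W N π

Interleave : ℕ → ℕ → List ℕ → Set
Interleave p q w =
  ∃ λ a → ∃ λ b → ∃ λ c → ∃ λ d → ∃ λ e →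
    w ≡ a ++ p ∷ b ++ q ∷ c ++ p ∷ d ++ q ∷ e

Compatible : ℕ → List ℕ → ℕ → ℕ → Set
Compatible N π p q =
  p ≢ q × (Interleave p q (W N π) ⊎ Interleave q p (W N π))

-- Pointers of the contraction of π ∈ S_{2n} (maximal strategic pile):
-- (p, p+1) for p ∈ ℤ_{2n-1}, represented by p ∈ {1, …, 2n-1}; the pointer
-- p stands for the pointer (p, p+1) of the uncontracted π (for p = 2n-1,
-- the pointer (2n-1,1) stands for (2n-1,2n)).
IsPointerM : ℕ → ℕ → Set
IsPointerM n p = 1 ≤ p × p ≤ 2 * n ∸ 1

uncontract : ℕ → ℕ → ℕ
uncontract n p = p

UniversalM : ℕ → List ℕ → ℕ → Set
UniversalM n π p =
  ∀ q → IsPointerM n q → q ≢ p →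
    Compatible (2 * n) π (uncontract n p) (uncontract n q)

prevM : ℕ → ℕ → ℕ
prevM n p = if p ≡ᵇ 1 then 2 * n ∸ 1 else p ∸ 1

nextM : ℕ → ℕ → ℕ
nextM n p = if p ≡ᵇ 2 * n ∸ 1 then 1 else suc p

-- Place the entry of π at index i on the points 2i and 2i + 1 of ℕ; the pointer p becomes the
-- chord from the right point of the entry p to the left point of the entry p + 1.  Two pointers
-- are compatible exactly when their chords cross, i.e. when exactly one endpoint of one of them
-- lies inside the other.  Let x, y, z be cyclically consecutive pointers with x and z universal.
-- Along the chain start 1, end 1, start 2, end 2, … the parity inside x ⊕ inside z does not
-- change across a pointer q ≠ x, z (x and z both cross q) nor across an entry (end q and
-- start (q + 1) are adjacent) away from the endpoints of x and z, so it is constant on the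
-- endpoints of all pointers other than x, y, z.  A finite check over the relative orders of the
-- endpoints of x, y and z shows that wherever this parity has that value, inside y ⊕ inside x is
-- constant too; hence y crosses every pointer that x crosses, and is universal.

module Submission where

open import Defs
open import Data.Nat using (ℕ; _≤_; _*_)
open import Data.List using (List)
open import Data.Sum using (_⊎_)
open import Relation.Nullary using (¬_)

open import Data.Bool using (Bool; true; false; not; _∧_; _∨_; _xor_; if_then_else_; T)
import Data.Bool.Properties as Bool
open import Data.Bool.Properties using (xor-comm)
open import Data.Unit using (tt)
open import Data.Nat using (zero; suc; pred; _∸_; _<_; _<ᵇ_; _≡ᵇ_; _≟_; _≤?_; z≤n; s≤s)
open import Data.Nat.Properties
  using (≤-refl; ≤-reflexive; ≤-trans; ≤-pred; <-trans; <-irrefl; <-asym; <-cmp; <⇒≤; <⇒≢; ≤∧≢⇒<; ≮⇒≥;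
         n≤1+n; n<1+n; m≤n⇒m≤1+n; m≤n⇒m<n∨m≡n; n≤0⇒n≡0; pred[n]≤n; <⇒≤pred; suc-injective;
         *-suc; *-monoʳ-≤; *-cancelˡ-≡; ∸-monoˡ-≤; even≢odd; <ᵇ⇒<; <⇒<ᵇ; ≡ᵇ⇒≡; ≡⇒≡ᵇ; allUpTo?)
open import Data.List using ([]; _∷_; _++_; [_]; map)
open import Data.List.Properties using (∷-injective; ∷-injectiveʳ; map-++)
open import Data.List.Relation.Unary.All as All using (All; []; _∷_)
open import Data.List.Relation.Unary.All.Properties using () renaming (++⁺ to All-++⁺)
open import Data.List.Relation.Unary.Any using (here; there)
open import Data.List.Relation.Unary.AllPairs using (AllPairs; []; _∷_)
open import Data.List.Relation.Unary.AllPairs.Properties using (++⁺)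
open import Data.List.Relation.Unary.Unique.Propositional using (Unique)
import Data.List.Relation.Unary.Unique.Propositional.Properties as Unique
open import Data.List.Membership.Propositional using (_∈_)
open import Data.List.Membership.Propositional.Properties using (∈-++⁺ʳ; ∈-++⁻; ∈-map⁺; ∈-upTo⁺)
open import Data.List.Relation.Binary.Permutation.Propositional using (↭-sym; ↭⇒↭ₛ)
open import Data.List.Relation.Binary.Permutation.Propositional.Properties using (∈-resp-↭)
import Data.List.Relation.Binary.Permutation.Setoid.Properties as Permutationₛ
open import Data.Vec using (Vec; []; _∷_)
open import Data.Product using (∃; _×_; _,_; proj₁; proj₂)
open import Data.Sum using (inj₁; inj₂)
open import Data.Empty using (⊥-elim)
open import Function using (_∘_)
open import Relation.Binary.Definitions using (tri<; tri≈; tri>)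
open import Relation.Binary.PropositionalEquality hiding ([_])
open import Relation.Nullary using (Dec; yes; no; contradiction)
open import Relation.Nullary.Decidable using (map′; ¬?; _→-dec_)

<ᵇ-true : ∀ {a b} → a < b → (a <ᵇ b) ≡ true
<ᵇ-true {zero} (s≤s _) = refl
<ᵇ-true {suc a} (s≤s a<b) = <ᵇ-true a<b

<ᵇ-false : ∀ {a b} → b ≤ a → (a <ᵇ b) ≡ false
<ᵇ-false {b = zero} _ = refl
<ᵇ-false (s≤s b≤a) = <ᵇ-false b≤a

<ᵇ≡true⇒< : ∀ a b → (a <ᵇ b) ≡ true → a < b
<ᵇ≡true⇒< a b a<b = <ᵇ⇒< a b (subst T (sym a<b) tt)

<ᵇ≡false⇒≥ : ∀ a b → (a <ᵇ b) ≡ false → b ≤ a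
<ᵇ≡false⇒≥ a b a≮b = ≮⇒≥ (λ a<b → subst T a≮b (<⇒<ᵇ a<b))

<ᵇ-sucʳ : ∀ a t → a ≢ t → (a <ᵇ suc t) ≡ (a <ᵇ t)
<ᵇ-sucʳ zero zero a≢t = ⊥-elim (a≢t refl)
<ᵇ-sucʳ zero (suc t) _ = refl
<ᵇ-sucʳ (suc a) zero _ = refl
<ᵇ-sucʳ (suc a) (suc t) a≢t = <ᵇ-sucʳ a t (λ e → a≢t (cong suc e))

<ᵇ-sucˡ : ∀ a t → t ≢ suc a → (suc a <ᵇ t) ≡ (a <ᵇ t)
<ᵇ-sucˡ a zero _ = refl
<ᵇ-sucˡ zero (suc zero) t≢1 = ⊥-elim (t≢1 refl)
<ᵇ-sucˡ zero (suc (suc t)) _ = refl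
<ᵇ-sucˡ (suc a) (suc t) t≢a = <ᵇ-sucˡ a t (λ e → t≢a (cong suc e))

<ᵇ-flip : ∀ a b → a ≢ b → (b <ᵇ a) ≡ not (a <ᵇ b)
<ᵇ-flip a b a≢b with <-cmp a b
... | tri< a<b _ _ = trans (<ᵇ-false (<⇒≤ a<b)) (cong not (sym (<ᵇ-true a<b)))
... | tri≈ _ a≡b _ = ⊥-elim (a≢b a≡b)
... | tri> _ _ b<a = trans (<ᵇ-true b<a) (cong not (sym (<ᵇ-false (<⇒≤ b<a))))

-- between a b t holds iff t lies in the half-open interval (min a b , max a b].
between : ℕ → ℕ → ℕ → Bool
between a b t = (a <ᵇ t) xor (b <ᵇ t)

crossing : ℕ → ℕ → ℕ → ℕ → Bool
crossing a b c d = between a b c xor between a b d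

between-comm : ∀ a b t → between a b t ≡ between b a t
between-comm a b t = xor-comm (a <ᵇ t) (b <ᵇ t)

between-suc : ∀ {a b t} → a ≢ t → b ≢ t → between a b (suc t) ≡ between a b t
between-suc {a} {b} {t} a≢t b≢t = cong₂ _xor_ (<ᵇ-sucʳ a t a≢t) (<ᵇ-sucʳ b t b≢t)

crossing-by : ∀ a b c d {ac bc ad bd} →
  (a <ᵇ c) ≡ ac → (b <ᵇ c) ≡ bc → (a <ᵇ d) ≡ ad → (b <ᵇ d) ≡ bd →
  crossing a b c d ≡ ((ac xor bc) xor (ad xor bd))
crossing-by a b c d refl refl refl refl = refl

ordered⇒crossing : ∀ {k₁ k₂ k₃ k₄} → k₁ < k₂ → k₂ < k₃ → k₃ < k₄ → crossing k₁ k₃ k₂ k₄ ≡ true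
ordered⇒crossing {k₁} {k₂} {k₃} {k₄} k₁<k₂ k₂<k₃ k₃<k₄ =
  crossing-by k₁ k₃ k₂ k₄ (<ᵇ-true k₁<k₂) (<ᵇ-false (<⇒≤ k₂<k₃))
             (<ᵇ-true (<-trans k₁<k₂ (<-trans k₂<k₃ k₃<k₄))) (<ᵇ-true k₃<k₄)

ordered⇒crossing′ : ∀ {k₁ k₂ k₃ k₄} → k₁ < k₂ → k₂ < k₃ → k₃ < k₄ → crossing k₂ k₄ k₁ k₃ ≡ true
ordered⇒crossing′ {k₁} {k₂} {k₃} {k₄} k₁<k₂ k₂<k₃ k₃<k₄ =
  crossing-by k₂ k₄ k₁ k₃ (<ᵇ-false (<⇒≤ k₁<k₂)) (<ᵇ-false (<⇒≤ (<-trans k₁<k₂ (<-trans k₂<k₃ k₃<k₄))))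
             (<ᵇ-true k₂<k₃) (<ᵇ-false (<⇒≤ k₃<k₄))

IsEnd : ℕ → ℕ → ℕ → Set
IsEnd a b k = k ≡ a ⊎ k ≡ b

crossing-endsˡ : ∀ {a b u u'} c d → IsEnd a b u → IsEnd a b u' → u ≢ u' →
  crossing u u' c d ≡ crossing a b c d
crossing-endsˡ c d (inj₁ refl) (inj₁ refl) u≢u' = ⊥-elim (u≢u' refl)
crossing-endsˡ c d (inj₁ refl) (inj₂ refl) _ = refl
crossing-endsˡ {a} {b} c d (inj₂ refl) (inj₁ refl) _ =
  cong₂ _xor_ (between-comm b a c) (between-comm b a d)
crossing-endsˡ c d (inj₂ refl) (inj₂ refl) u≢u' = ⊥-elim (u≢u' refl)

crossing-endsʳ : ∀ {c d v v'} a b → IsEnd c d v → IsEnd c d v' → v ≢ v' →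
  crossing a b v v' ≡ crossing a b c d
crossing-endsʳ a b (inj₁ refl) (inj₁ refl) v≢v' = ⊥-elim (v≢v' refl)
crossing-endsʳ a b (inj₁ refl) (inj₂ refl) _ = refl
crossing-endsʳ {c} {d} a b (inj₂ refl) (inj₁ refl) _ = xor-comm (between a b d) (between a b c)
crossing-endsʳ a b (inj₂ refl) (inj₂ refl) v≢v' = ⊥-elim (v≢v' refl)

Alternating : ℕ → ℕ → ℕ → ℕ → Set
Alternating a b c d = ∃ λ k₁ → ∃ λ k₂ → ∃ λ k₃ → ∃ λ k₄ →
  k₁ < k₂ × k₂ < k₃ × k₃ < k₄ × IsEnd a b k₁ × IsEnd c d k₂ × IsEnd a b k₃ × IsEnd c d k₄

alternating⇒crossing : ∀ {a b c d} → Alternating a b c d → crossing a b c d ≡ true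
alternating⇒crossing {a} {b} {c} {d} (k₁ , k₂ , k₃ , k₄ , k₁<k₂ , k₂<k₃ , k₃<k₄ , e₁ , e₂ , e₃ , e₄) =
  begin
    crossing a b c d     ≡⟨ crossing-endsˡ c d e₁ e₃ (<⇒≢ (<-trans k₁<k₂ k₂<k₃)) ⟨
    crossing k₁ k₃ c d   ≡⟨ crossing-endsʳ k₁ k₃ e₂ e₄ (<⇒≢ (<-trans k₂<k₃ k₃<k₄)) ⟨
    crossing k₁ k₃ k₂ k₄ ≡⟨ ordered⇒crossing k₁<k₂ k₂<k₃ k₃<k₄ ⟩
    true                 ∎
  where open ≡-Reasoning

alternating⇒crossing′ : ∀ {a b c d} → Alternating c d a b → crossing a b c d ≡ true
alternating⇒crossing′ {a} {b} {c} {d} (k₁ , k₂ , k₃ , k₄ , k₁<k₂ , k₂<k₃ , k₃<k₄ , e₁ , e₂ , e₃ , e₄) =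
  begin
    crossing a b c d     ≡⟨ crossing-endsˡ c d e₂ e₄ (<⇒≢ (<-trans k₂<k₃ k₃<k₄)) ⟨
    crossing k₂ k₄ c d   ≡⟨ crossing-endsʳ k₂ k₄ e₁ e₃ (<⇒≢ (<-trans k₁<k₂ k₂<k₃)) ⟨
    crossing k₂ k₄ k₁ k₃ ≡⟨ ordered⇒crossing′ k₁<k₂ k₂<k₃ k₃<k₄ ⟩
    true                 ∎
  where open ≡-Reasoning

Separated : ℕ → ℕ → ℕ → ℕ → Set
Separated a b c d = ∀ {u v} → IsEnd a b u → IsEnd c d v → u ≢ v

sort-ends : ∀ a b → a ≢ b → ∃ λ u → ∃ λ u' → u < u' × IsEnd a b u × IsEnd a b u'
sort-ends a b a≢b with <-cmp a b
... | tri< a<b _ _ = a , b , a<b , inj₁ refl , inj₂ refl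
... | tri≈ _ a≡b _ = ⊥-elim (a≢b a≡b)
... | tri> _ _ b<a = b , a , b<a , inj₂ refl , inj₁ refl

crossing-order : ∀ {u u' v v'} → u < u' → v < v' →
  u ≢ v → u ≢ v' → u' ≢ v → u' ≢ v' → crossing u u' v v' ≡ true →
  (u < v × v < u' × u' < v') ⊎ (v < u × u < v' × v' < u')
crossing-order {u} {u'} {v} {v'} u<u' v<v' u≢v u≢v' u'≢v u'≢v' cross with <-cmp v u
... | tri≈ _ v≡u _ = ⊥-elim (u≢v (sym v≡u))
... | tri< v<u _ _ with <-cmp v' u
...   | tri≈ _ v'≡u _ = ⊥-elim (u≢v' (sym v'≡u))
...   | tri< v'<u _ _ = contradiction (trans (sym cross)
          (crossing-by u u' v v' (<ᵇ-false (<⇒≤ v<u)) (<ᵇ-false (<⇒≤ (<-trans v<u u<u')))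
                               (<ᵇ-false (<⇒≤ v'<u)) (<ᵇ-false (<⇒≤ (<-trans v'<u u<u'))))) λ ()
...   | tri> _ _ u<v' with <-cmp v' u'
...     | tri< v'<u' _ _ = inj₂ (v<u , u<v' , v'<u')
...     | tri≈ _ v'≡u' _ = ⊥-elim (u'≢v' (sym v'≡u'))
...     | tri> _ _ u'<v' = contradiction (trans (sym cross)
          (crossing-by u u' v v' (<ᵇ-false (<⇒≤ v<u)) (<ᵇ-false (<⇒≤ (<-trans v<u u<u')))
                               (<ᵇ-true u<v') (<ᵇ-true u'<v'))) λ ()
crossing-order {u} {u'} {v} {v'} u<u' v<v' u≢v u≢v' u'≢v u'≢v' cross | tri> _ _ u<v with <-cmp v u'
... | tri≈ _ v≡u' _ = ⊥-elim (u'≢v (sym v≡u'))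
... | tri> _ _ u'<v = contradiction (trans (sym cross)
          (crossing-by u u' v v' (<ᵇ-true u<v) (<ᵇ-true u'<v)
                               (<ᵇ-true (<-trans u<v v<v')) (<ᵇ-true (<-trans u'<v v<v')))) λ ()
... | tri< v<u' _ _ with <-cmp v' u'
...   | tri< v'<u' _ _ = contradiction (trans (sym cross)
          (crossing-by u u' v v' (<ᵇ-true u<v) (<ᵇ-false (<⇒≤ v<u'))
                               (<ᵇ-true (<-trans u<v v<v')) (<ᵇ-false (<⇒≤ v'<u')))) λ ()
...   | tri≈ _ v'≡u' _ = ⊥-elim (u'≢v' (sym v'≡u'))
...   | tri> _ _ u'<v' = inj₁ (u<v , v<u' , u'<v')

crossing⇒alternating : ∀ {a b c d} → a ≢ b → c ≢ d → Separated a b c d →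
  crossing a b c d ≡ true → Alternating a b c d ⊎ Alternating c d a b
crossing⇒alternating {a} {b} {c} {d} a≢b c≢d sep cross
  with sort-ends a b a≢b | sort-ends c d c≢d
... | u , u' , u<u' , eu , eu' | v , v' , v<v' , ev , ev'
  with crossing-order u<u' v<v' (sep eu ev) (sep eu ev') (sep eu' ev) (sep eu' ev') sorted-cross
  where
  sorted-cross : crossing u u' v v' ≡ true
  sorted-cross = trans (crossing-endsʳ u u' ev ev' (<⇒≢ v<v'))
                       (trans (crossing-endsˡ c d eu eu' (<⇒≢ u<u')) cross)
... | inj₁ (u<v , v<u' , u'<v') = inj₁ (u , v , u' , v' , u<v , v<u' , u'<v' , eu , ev , eu' , ev')
... | inj₂ (v<u , u<v' , v'<u') = inj₂ (v , u , v' , u' , v<u , u<v' , v'<u' , ev , eu , ev' , eu')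

crossing-sym : ∀ {a b c d} → a ≢ b → c ≢ d → Separated a b c d →
  crossing a b c d ≡ true → crossing c d a b ≡ true
crossing-sym a≢b c≢d sep cross with crossing⇒alternating a≢b c≢d sep cross
... | inj₁ alt = alternating⇒crossing′ alt
... | inj₂ alt = alternating⇒crossing alt

-- a label (a pointer) together with a key (its place in the pointer word)
Keyed : Set
Keyed = ℕ × ℕ

_<ₖ_ : Keyed → Keyed → Set
x <ₖ y = proj₂ x < proj₂ y

Sorted : List Keyed → Set
Sorted = AllPairs _<ₖ_

labels : List Keyed → List ℕ
labels = map proj₁

KeysAlternate : ℕ → ℕ → List Keyed → Set
KeysAlternate p q l = ∃ λ k₁ → ∃ λ k₂ → ∃ λ k₃ → ∃ λ k₄ →
  k₁ < k₂ × k₂ < k₃ × k₃ < k₄ × (p , k₁) ∈ l × (q , k₂) ∈ l × (p , k₃) ∈ l × (q , k₄) ∈ l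

labels-split : ∀ {l} a {p r} → Sorted l → labels l ≡ a ++ p ∷ r →
  ∃ λ k → ∃ λ l' → (p , k) ∈ l × Sorted l' × labels l' ≡ r ×
    (∀ {y} → y ∈ l' → y ∈ l × k < proj₂ y)
labels-split {[]} [] _ ()
labels-split {[]} (_ ∷ _) _ ()
labels-split {(_ , k) ∷ l} [] (k<l ∷ sorted) eq with ∷-injective eq
... | refl , labels-l≡r =
  k , l , here refl , sorted , labels-l≡r , λ y∈l → there y∈l , All.lookup k<l y∈l
labels-split {_ ∷ l} (_ ∷ a) (_ ∷ sorted) eq with labels-split a sorted (∷-injectiveʳ eq)
... | k , l' , p∈l , sorted' , eq' , sub =
  k , l' , there p∈l , sorted' , eq' , λ y∈l' → there (proj₁ (sub y∈l')) , proj₂ (sub y∈l')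

interleave⇒keysAlternate : ∀ {p q l} → Sorted l → Interleave p q (labels l) → KeysAlternate p q l
interleave⇒keysAlternate sorted (a , b , c , d , _ , eq)
  with labels-split a sorted eq
... | k₁ , _ , m₁ , sorted₁ , eq₁ , sub₁ with labels-split b sorted₁ eq₁
... | k₂ , _ , m₂ , sorted₂ , eq₂ , sub₂ with labels-split c sorted₂ eq₂
... | k₃ , _ , m₃ , sorted₃ , eq₃ , sub₃ with labels-split d sorted₃ eq₃
... | k₄ , _ , m₄ , _ =
  k₁ , k₂ , k₃ , k₄ , proj₂ (sub₁ m₂) , proj₂ (sub₂ m₃) , proj₂ (sub₃ m₄) ,
  m₁ , proj₁ (sub₁ m₂) , proj₁ (sub₁ (proj₁ (sub₂ m₃))) ,
  proj₁ (sub₁ (proj₁ (sub₂ (proj₁ (sub₃ m₄)))))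

split-at : ∀ {l y} → Sorted l → y ∈ l →
  ∃ λ a → ∃ λ r → l ≡ a ++ y ∷ r × Sorted r × (∀ {z} → z ∈ l → y <ₖ z → z ∈ r)
split-at {y ∷ r} (_ ∷ sorted) (here refl) = [] , r , refl , sorted , later
  where
  later : ∀ {z} → z ∈ y ∷ r → y <ₖ z → z ∈ r
  later (here refl) y<y = ⊥-elim (<-irrefl refl y<y)
  later (there z∈r) _ = z∈r
split-at {x ∷ l} {y} (x<l ∷ sorted) (there y∈l) with split-at sorted y∈l
... | a , r , refl , sorted-r , later = x ∷ a , r , refl , sorted-r , later′
  where
  later′ : ∀ {z} → z ∈ x ∷ l → y <ₖ z → z ∈ r
  later′ (here refl) y<x = ⊥-elim (<-asym y<x (All.lookup x<l y∈l))
  later′ (there z∈l) y<z = later z∈l y<z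

keysAlternate⇒interleave : ∀ {p q l} → Sorted l → KeysAlternate p q l → Interleave p q (labels l)
keysAlternate⇒interleave {p} {q} sorted (k₁ , k₂ , k₃ , k₄ , k₁<k₂ , k₂<k₃ , k₃<k₄ , m₁ , m₂ , m₃ , m₄)
  with split-at sorted m₁
... | a , _ , refl , sorted₁ , later₁
  with split-at sorted₁ (later₁ m₂ k₁<k₂)
... | b , _ , refl , sorted₂ , later₂
  with split-at sorted₂ (later₂ (later₁ m₃ (<-trans k₁<k₂ k₂<k₃)) k₂<k₃)
... | c , _ , refl , sorted₃ , later₃
  with split-at sorted₃ (later₃ (later₂ (later₁ m₄ k₁<k₄) k₂<k₄) k₃<k₄)
  where k₂<k₄ = <-trans k₂<k₃ k₃<k₄
        k₁<k₄ = <-trans k₁<k₂ k₂<k₄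
... | d , e , refl , _ =
  labels a , labels b , labels c , labels d , labels e , (begin
    labels (a ++ (p , k₁) ∷ b ++ (q , k₂) ∷ c ++ (p , k₃) ∷ d ++ (q , k₄) ∷ e)
      ≡⟨ map-++ proj₁ a _ ⟩
    labels a ++ p ∷ labels (b ++ (q , k₂) ∷ c ++ (p , k₃) ∷ d ++ (q , k₄) ∷ e)
      ≡⟨ cong (λ w → labels a ++ p ∷ w) (map-++ proj₁ b _) ⟩
    labels a ++ p ∷ labels b ++ q ∷ labels (c ++ (p , k₃) ∷ d ++ (q , k₄) ∷ e)
      ≡⟨ cong (λ w → labels a ++ p ∷ labels b ++ q ∷ w) (map-++ proj₁ c _) ⟩
    labels a ++ p ∷ labels b ++ q ∷ labels c ++ p ∷ labels (d ++ (q , k₄) ∷ e)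
      ≡⟨ cong (λ w → labels a ++ p ∷ labels b ++ q ∷ labels c ++ p ∷ w) (map-++ proj₁ d _) ⟩
    labels a ++ p ∷ labels b ++ q ∷ labels c ++ p ∷ labels d ++ q ∷ labels e ∎)
  where open ≡-Reasoning

≡ᵇ-false : ∀ {m n} → m ≢ n → (m ≡ᵇ n) ≡ false
≡ᵇ-false {m} {n} m≢n with m ≡ᵇ n in eq
... | true = ⊥-elim (m≢n (≡ᵇ⇒≡ m n (subst T (sym eq) tt)))
... | false = refl

≡ᵇ-true : ∀ {m n} → (m ≡ᵇ n) ≡ true → m ≡ n
≡ᵇ-true {m} {n} eq = ≡ᵇ⇒≡ m n (subst T (sym eq) tt)

keyedW : ℕ → (ℕ → ℕ) → List ℕ → List Keyed
keyedW N κ [] = []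
keyedW N κ (k ∷ π) =
  (if k ≡ᵇ 1 then [] else [ (k ∸ 1 , 2 * κ k) ]) ++
  (if k ≡ᵇ N then [] else [ (k , suc (2 * κ k)) ]) ++ keyedW N κ π

labels-keyedW : ∀ N κ π → labels (keyedW N κ π) ≡ W N π
labels-keyedW N κ [] = refl
labels-keyedW N κ (k ∷ π) with k ≡ᵇ 1 | k ≡ᵇ N
... | true | true = labels-keyedW N κ π
... | true | false = cong (k ∷_) (labels-keyedW N κ π)
... | false | true = cong (k ∸ 1 ∷_) (labels-keyedW N κ π)
... | false | false = cong (λ w → k ∸ 1 ∷ k ∷ w) (labels-keyedW N κ π)

right∈keyedW : ∀ N κ {π k} → k ∈ π → k ≢ N → (k , suc (2 * κ k)) ∈ keyedW N κ π
right∈keyedW N κ {k ∷ π} (here refl) k≢N rewrite ≡ᵇ-false k≢N =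
  ∈-++⁺ʳ (if k ≡ᵇ 1 then [] else [ (k ∸ 1 , 2 * κ k) ]) (here refl)
right∈keyedW N κ {x ∷ π} (there k∈π) k≢N =
  ∈-++⁺ʳ (if x ≡ᵇ 1 then [] else _) (∈-++⁺ʳ (if x ≡ᵇ N then [] else _) (right∈keyedW N κ k∈π k≢N))

left∈keyedW : ∀ N κ {π k} → k ∈ π → k ≢ 1 → (k ∸ 1 , 2 * κ k) ∈ keyedW N κ π
left∈keyedW N κ {k ∷ π} (here refl) k≢1 rewrite ≡ᵇ-false k≢1 = here refl
left∈keyedW N κ {x ∷ π} (there k∈π) k≢1 =
  ∈-++⁺ʳ (if x ≡ᵇ 1 then [] else _) (∈-++⁺ʳ (if x ≡ᵇ N then [] else _) (left∈keyedW N κ k∈π k≢1))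

∈-if-[] : ∀ {A : Set} b {x y : A} → y ∈ (if b then [] else [ x ]) → y ≡ x
∈-if-[] false (here refl) = refl

keyedW-ends : ∀ N κ {π ℓ key} → 1 ≤ ℓ → (ℓ , key) ∈ keyedW N κ π →
  IsEnd (suc (2 * κ ℓ)) (2 * κ (suc ℓ)) key
keyedW-ends N κ {x ∷ π} 1≤ℓ ℓ∈ with ∈-++⁻ (if x ≡ᵇ 1 then [] else _) ℓ∈
... | inj₁ ℓ∈left with ∈-if-[] (x ≡ᵇ 1) ℓ∈left
...   | refl = inj₂ (cong (λ k → 2 * κ k) (sym (suc-pred x 1≤ℓ)))
  where
  suc-pred : ∀ x → 1 ≤ x ∸ 1 → suc (x ∸ 1) ≡ x
  suc-pred (suc _) _ = refl
keyedW-ends N κ {x ∷ π} 1≤ℓ ℓ∈ | inj₂ ℓ∈rest with ∈-++⁻ (if x ≡ᵇ N then [] else _) ℓ∈rest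
... | inj₁ ℓ∈right with ∈-if-[] (x ≡ᵇ N) ℓ∈right
...   | refl = inj₁ refl
keyedW-ends N κ {x ∷ π} 1≤ℓ ℓ∈ | inj₂ ℓ∈rest | inj₂ ℓ∈π = keyedW-ends N κ {π} 1≤ℓ ℓ∈π

All-if-[] : ∀ {P : Keyed → Set} b {e} → P e → All P (if b then [] else [ e ])
All-if-[] true _ = []
All-if-[] false pe = pe ∷ []

sorted-if-[] : ∀ b {e} → Sorted (if b then [] else [ e ])
sorted-if-[] true = []
sorted-if-[] false = [] ∷ []

keyedW-keys-≥ : ∀ N κ {lo π} → All (λ y → lo ≤ κ y) π → All (λ e → 2 * lo ≤ proj₂ e) (keyedW N κ π)
keyedW-keys-≥ N κ [] = []
keyedW-keys-≥ N κ {lo} {x ∷ π} (lo≤κx ∷ lo≤κπ) =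
  All-++⁺ (All-if-[] (x ≡ᵇ 1) (*-monoʳ-≤ 2 lo≤κx))
    (All-++⁺ (All-if-[] (x ≡ᵇ N) (≤-trans (*-monoʳ-≤ 2 lo≤κx) (n≤1+n _)))
      (keyedW-keys-≥ N κ lo≤κπ))

keyedW-sorted : ∀ N κ {π} → AllPairs (λ a b → κ a < κ b) π → Sorted (keyedW N κ π)
keyedW-sorted N κ [] = []
keyedW-sorted N κ {x ∷ π} (κx<κπ ∷ κ-increasing) =
  ++⁺ (sorted-if-[] (x ≡ᵇ 1)) (++⁺ (sorted-if-[] (x ≡ᵇ N)) (keyedW-sorted N κ κ-increasing)
        (All-if-[] (x ≡ᵇ N) right<rest))
      (All-if-[] (x ≡ᵇ 1) (All-++⁺ (All-if-[] (x ≡ᵇ N) ≤-refl) (All.map (≤-trans (n≤1+n _)) right<rest)))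
  where
  right<rest : All (λ e → suc (2 * κ x) < proj₂ e) (keyedW N κ π)
  right<rest = All.map (λ {e} h → subst (_≤ proj₂ e) (*-suc 2 (κ x)) h) (keyedW-keys-≥ N κ κx<κπ)

position : List ℕ → ℕ → ℕ
position [] _ = 0
position (x ∷ xs) k with x ≟ k
... | yes _ = 0
... | no _ = suc (position xs k)

position-head : ∀ x xs → position (x ∷ xs) x ≡ 0
position-head x xs with x ≟ x
... | yes _ = refl
... | no x≢x = ⊥-elim (x≢x refl)

position-∷ : ∀ {x k} xs → x ≢ k → position (x ∷ xs) k ≡ suc (position xs k)
position-∷ {x} {k} xs x≢k with x ≟ k
... | yes x≡k = ⊥-elim (x≢k x≡k)
... | no _ = refl

position-injective : ∀ {π k j} → k ∈ π → position π k ≡ position π j → k ≡ j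
position-injective {x ∷ xs} {k} {j} k∈π eq with x ≟ k | x ≟ j
... | yes refl | yes refl = refl
... | no x≢k | no _ with k∈π
...   | here x≡k = ⊥-elim (x≢k (sym x≡k))
...   | there k∈xs = position-injective k∈xs (suc-injective eq)

position-increasing : ∀ {π} → Unique π → AllPairs (λ a b → position π a < position π b) π
position-increasing {[]} [] = []
position-increasing {x ∷ xs} (x∉xs ∷ unique) =
  All.map head<  x∉xs ∷ shift x∉xs (position-increasing unique)
  where
  head< : ∀ {b} → x ≢ b → position (x ∷ xs) x < position (x ∷ xs) b
  head< {b} x≢b rewrite position-head x xs | position-∷ xs x≢b = s≤s z≤n
  shift : ∀ {ys} → All (x ≢_) ys → AllPairs (λ a b → position xs a < position xs b) ys →
          AllPairs (λ a b → position (x ∷ xs) a < position (x ∷ xs) b) ys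
  shift [] [] = []
  shift {a ∷ _} (x≢a ∷ x∉ys) (a<ys ∷ increasing) =
    All.zipWith (λ { {b} (x≢b , a<b) →
                    subst₂ _<_ (sym (position-∷ xs x≢a)) (sym (position-∷ xs x≢b)) (s≤s a<b) })
                (x∉ys , a<ys)
    ∷ shift x∉ys increasing

module Chords (m : ℕ) (κ : ℕ → ℕ)
  (κ-injective : ∀ {a b} → 1 ≤ a → a ≤ suc m → 1 ≤ b → b ≤ suc m → κ a ≡ κ b → a ≡ b) where

  IsPointer : ℕ → Set
  IsPointer p = 1 ≤ p × p ≤ m

  -- κ k is the index of the entry k in π; the pointer p joins the right side of the
  -- entry p to the left side of the entry p + 1.
  start : ℕ → ℕ
  start p = suc (2 * κ p)

  end : ℕ → ℕ
  end p = 2 * κ (suc p)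

  inside : ℕ → ℕ → Bool
  inside p = between (start p) (end p)

  _crosses_ : ℕ → ℕ → Bool
  p crosses q = crossing (start p) (end p) (start q) (end q)

  Universal : ℕ → Set
  Universal p = ∀ q → IsPointer q → q ≢ p → p crosses q ≡ true

  start≢end : ∀ p q → start p ≢ end q
  start≢end p q e = even≢odd (κ (suc q)) (κ p) (sym e)

  start-injective : ∀ {p q} → IsPointer p → IsPointer q → p ≢ q → start p ≢ start q
  start-injective (1≤p , p≤m) (1≤q , q≤m) p≢q e =
    p≢q (κ-injective 1≤p (m≤n⇒m≤1+n p≤m) 1≤q (m≤n⇒m≤1+n q≤m) (*-cancelˡ-≡ _ _ 2 (suc-injective e)))

  end-injective : ∀ {p q} → p ≤ m → q ≤ m → p ≢ q → end p ≢ end q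
  end-injective p≤m q≤m p≢q e =
    p≢q (suc-injective (κ-injective (s≤s z≤n) (s≤s p≤m) (s≤s z≤n) (s≤s q≤m) (*-cancelˡ-≡ _ _ 2 e)))

  separated : ∀ {p q} → IsPointer p → IsPointer q → p ≢ q →
    Separated (start p) (end p) (start q) (end q)
  separated P Q p≢q (inj₁ refl) (inj₁ refl) = start-injective P Q p≢q
  separated {p} {q} _ _ _ (inj₁ refl) (inj₂ refl) = start≢end p q
  separated {p} {q} _ _ _ (inj₂ refl) (inj₁ refl) = ≢-sym (start≢end q p)
  separated (_ , p≤m) (_ , q≤m) p≢q (inj₂ refl) (inj₂ refl) = end-injective p≤m q≤m p≢q

  crosses-sym : ∀ {p q} → IsPointer p → IsPointer q → p ≢ q → p crosses q ≡ true → q crosses p ≡ true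
  crosses-sym {p} {q} P Q p≢q = crossing-sym (start≢end p p) (start≢end q q) (separated P Q p≢q)

perm⇒unique : ∀ {N π} → IsPerm N π → Unique π
perm⇒unique {N} π↭ =
  Permutationₛ.Unique-resp-↭ (setoid ℕ) (↭⇒↭ₛ (↭-sym π↭)) (Unique.map⁺ suc-injective (Unique.upTo⁺ N))

perm⇒∈ : ∀ {N π k} → IsPerm N π → 1 ≤ k → k ≤ N → k ∈ π
perm⇒∈ π↭ (s≤s {n = k} _) k≤N = ∈-resp-↭ (↭-sym π↭) (∈-map⁺ suc (∈-upTo⁺ {i = k} k≤N))

position-injective-on : ∀ {m π} → IsPerm (suc m) π → ∀ {a b} → 1 ≤ a → a ≤ suc m → 1 ≤ b → b ≤ suc m →
  position π a ≡ position π b → a ≡ b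
position-injective-on π↭ 1≤a a≤N _ _ = position-injective (perm⇒∈ π↭ 1≤a a≤N)

module CompatibleCrossing (m : ℕ) (π : List ℕ) (π↭ : IsPerm (suc m) π) where

  open Chords m (position π) (position-injective-on π↭) public

  private
    N = suc m

    word : List Keyed
    word = keyedW N (position π) π

    word-sorted : Sorted word
    word-sorted = keyedW-sorted N (position π) (position-increasing (perm⇒unique π↭))

    W≡labels : W N π ≡ labels word
    W≡labels = sym (labels-keyedW N (position π) π)

    ∈word⇒end : ∀ {p k} → 1 ≤ p → (p , k) ∈ word → IsEnd (start p) (end p) k
    ∈word⇒end = keyedW-ends N (position π) {π}

    end⇒∈word : ∀ {p k} → IsPointer p → IsEnd (start p) (end p) k → (p , k) ∈ word
    end⇒∈word (1≤p , p≤m) (inj₁ refl) =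
      right∈keyedW N (position π) (perm⇒∈ π↭ 1≤p (m≤n⇒m≤1+n p≤m)) (<⇒≢ (s≤s p≤m))
    end⇒∈word (1≤p , p≤m) (inj₂ refl) =
      left∈keyedW N (position π) (perm⇒∈ π↭ (s≤s z≤n) (s≤s p≤m)) (λ e → <⇒≢ 1≤p (sym (suc-injective e)))

    keysAlternate⇒alternating : ∀ {p q} → 1 ≤ p → 1 ≤ q → KeysAlternate p q word →
      Alternating (start p) (end p) (start q) (end q)
    keysAlternate⇒alternating 1≤p 1≤q (k₁ , k₂ , k₃ , k₄ , k₁<k₂ , k₂<k₃ , k₃<k₄ , m₁ , m₂ , m₃ , m₄) =
      k₁ , k₂ , k₃ , k₄ , k₁<k₂ , k₂<k₃ , k₃<k₄ ,
      ∈word⇒end 1≤p m₁ , ∈word⇒end 1≤q m₂ , ∈word⇒end 1≤p m₃ , ∈word⇒end 1≤q m₄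

    alternating⇒keysAlternate : ∀ {p q} → IsPointer p → IsPointer q →
      Alternating (start p) (end p) (start q) (end q) → KeysAlternate p q word
    alternating⇒keysAlternate P Q (k₁ , k₂ , k₃ , k₄ , k₁<k₂ , k₂<k₃ , k₃<k₄ , e₁ , e₂ , e₃ , e₄) =
      k₁ , k₂ , k₃ , k₄ , k₁<k₂ , k₂<k₃ , k₃<k₄ ,
      end⇒∈word P e₁ , end⇒∈word Q e₂ , end⇒∈word P e₃ , end⇒∈word Q e₄

  compatible⇒crosses : ∀ {p q} → 1 ≤ p → 1 ≤ q → Compatible (suc m) π p q → p crosses q ≡ true
  compatible⇒crosses {p} {q} 1≤p 1≤q (_ , inj₁ pq) =
    alternating⇒crossing (keysAlternate⇒alternating 1≤p 1≤q
      (interleave⇒keysAlternate word-sorted (subst (Interleave p q) W≡labels pq)))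
  compatible⇒crosses {p} {q} 1≤p 1≤q (_ , inj₂ qp) =
    alternating⇒crossing′ (keysAlternate⇒alternating 1≤q 1≤p
      (interleave⇒keysAlternate word-sorted (subst (Interleave q p) W≡labels qp)))

  crosses⇒compatible : ∀ {p q} → IsPointer p → IsPointer q → p ≢ q → p crosses q ≡ true →
    Compatible (suc m) π p q
  crosses⇒compatible {p} {q} P Q p≢q cross
    with crossing⇒alternating (start≢end p p) (start≢end q q) (separated P Q p≢q) cross
  ... | inj₁ alt = p≢q , inj₁ (subst (Interleave p q) (sym W≡labels)
                     (keysAlternate⇒interleave word-sorted (alternating⇒keysAlternate P Q alt)))
  ... | inj₂ alt = p≢q , inj₂ (subst (Interleave q p) (sym W≡labels)
                     (keysAlternate⇒interleave word-sorted (alternating⇒keysAlternate Q P alt)))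

-- interior-region, interior-bridge, first-region and last-region below concern the relative
-- order of at most six numbers.  Once every comparison with a successor is rewritten into one
-- between the listed points, each becomes a Boolean implication between the pairwise
-- comparisons, verified by evaluation on all assignments of them (those violating
-- transitivity being excluded by consistentₖ).
_⇒ᵇ_ : Bool → Bool → Bool
true ⇒ᵇ b = b
false ⇒ᵇ b = true
infixr 1 _⇒ᵇ_

⇒ᵇ-elim : ∀ {a b} → (a ⇒ᵇ b) ≡ true → a ≡ true → b ≡ true
⇒ᵇ-elim {true} a⇒b refl = a⇒b

_==_ : Bool → Bool → Bool
a == b = not (a xor b)

==-sound : ∀ {a b} → (a == b) ≡ true → a ≡ b
==-sound {true} {true} _ = refl
==-sound {false} {false} _ = refl

==-complete : ∀ {a b} → a ≡ b → (a == b) ≡ true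
==-complete {true} refl = refl
==-complete {false} refl = refl

allBits : ∀ n → (Vec Bool n → Bool) → Bool
allBits zero f = f []
allBits (suc n) f = allBits n (λ v → f (true ∷ v)) ∧ allBits n (λ v → f (false ∷ v))

allBits-sound : ∀ n f → allBits n f ≡ true → ∀ v → f v ≡ true
allBits-sound zero f holds [] = holds
allBits-sound (suc n) f holds (true ∷ v) with allBits n (λ v → f (true ∷ v)) in holds-true
... | true = allBits-sound n _ holds-true v
allBits-sound (suc n) f holds (false ∷ v) with allBits n (λ v → f (true ∷ v))
... | true = allBits-sound n _ holds v

-- ab, bc and ac can be the values of a <ᵇ b, b <ᵇ c and a <ᵇ c
transitiveᵇ : Bool → Bool → Bool → Bool
transitiveᵇ ab bc ac = (not (ab ∧ bc) ∨ ac) ∧ (ab ∨ bc ∨ not ac)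

transitiveᵇ-<ᵇ : ∀ a b c → transitiveᵇ (a <ᵇ b) (b <ᵇ c) (a <ᵇ c) ≡ true
transitiveᵇ-<ᵇ a b c with a <ᵇ b in ab | b <ᵇ c in bc | a <ᵇ c in ac
... | true | true | true = refl
... | true | true | false
  with () ← trans (sym ac) (<ᵇ-true (<-trans (<ᵇ≡true⇒< a b ab) (<ᵇ≡true⇒< b c bc)))
... | true | false | _ = refl
... | false | true | _ = refl
... | false | false | false = refl
... | false | false | true
  with () ← trans (sym ac) (<ᵇ-false (≤-trans (<ᵇ≡false⇒≥ b c bc) (<ᵇ≡false⇒≥ a b ab)))

-- cᵢⱼ stands for pᵢ <ᵇ pⱼ, for points p₀ p₁ … in the order in which they are listed.
consistent₄ : Bool → Bool → Bool → Bool → Bool → Bool → Bool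
consistent₄ c01 c02 c03 c12 c13 c23 =
  transitiveᵇ c01 c12 c02 ∧ transitiveᵇ c01 c13 c03 ∧ transitiveᵇ c02 c23 c03 ∧ transitiveᵇ c12 c23 c13

consistent₄-<ᵇ : ∀ a b c d →
  consistent₄ (a <ᵇ b) (a <ᵇ c) (a <ᵇ d) (b <ᵇ c) (b <ᵇ d) (c <ᵇ d) ≡ true
consistent₄-<ᵇ a b c d
  rewrite transitiveᵇ-<ᵇ a b c | transitiveᵇ-<ᵇ a b d | transitiveᵇ-<ᵇ a c d | transitiveᵇ-<ᵇ b c d = refl

consistent₅ : Bool → Bool → Bool → Bool → Bool → Bool → Bool → Bool → Bool → Bool → Bool
consistent₅ c01 c02 c03 c04 c12 c13 c14 c23 c24 c34 =
  transitiveᵇ c01 c12 c02 ∧ transitiveᵇ c01 c13 c03 ∧ transitiveᵇ c01 c14 c04 ∧ transitiveᵇ c02 c23 c03 ∧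
  transitiveᵇ c02 c24 c04 ∧ transitiveᵇ c03 c34 c04 ∧ transitiveᵇ c12 c23 c13 ∧ transitiveᵇ c12 c24 c14 ∧
  transitiveᵇ c13 c34 c14 ∧ transitiveᵇ c23 c34 c24

consistent₅-<ᵇ : ∀ a b c d e →
  consistent₅ (a <ᵇ b) (a <ᵇ c) (a <ᵇ d) (a <ᵇ e) (b <ᵇ c) (b <ᵇ d) (b <ᵇ e)
              (c <ᵇ d) (c <ᵇ e) (d <ᵇ e) ≡ true
consistent₅-<ᵇ a b c d e
  rewrite transitiveᵇ-<ᵇ a b c | transitiveᵇ-<ᵇ a b d | transitiveᵇ-<ᵇ a b e | transitiveᵇ-<ᵇ a c d
        | transitiveᵇ-<ᵇ a c e | transitiveᵇ-<ᵇ a d e | transitiveᵇ-<ᵇ b c d | transitiveᵇ-<ᵇ b c e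
        | transitiveᵇ-<ᵇ b d e | transitiveᵇ-<ᵇ c d e = refl

consistent₆ : Bool → Bool → Bool → Bool → Bool → Bool → Bool → Bool → Bool → Bool →
              Bool → Bool → Bool → Bool → Bool → Bool
consistent₆ c01 c02 c03 c04 c05 c12 c13 c14 c15 c23 c24 c25 c34 c35 c45 =
  transitiveᵇ c01 c12 c02 ∧ transitiveᵇ c01 c13 c03 ∧ transitiveᵇ c01 c14 c04 ∧ transitiveᵇ c01 c15 c05 ∧
  transitiveᵇ c02 c23 c03 ∧ transitiveᵇ c02 c24 c04 ∧ transitiveᵇ c02 c25 c05 ∧ transitiveᵇ c03 c34 c04 ∧
  transitiveᵇ c03 c35 c05 ∧ transitiveᵇ c04 c45 c05 ∧ transitiveᵇ c12 c23 c13 ∧ transitiveᵇ c12 c24 c14 ∧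
  transitiveᵇ c12 c25 c15 ∧ transitiveᵇ c13 c34 c14 ∧ transitiveᵇ c13 c35 c15 ∧ transitiveᵇ c14 c45 c15 ∧
  transitiveᵇ c23 c34 c24 ∧ transitiveᵇ c23 c35 c25 ∧ transitiveᵇ c24 c45 c25 ∧ transitiveᵇ c34 c45 c35

consistent₆-<ᵇ : ∀ a b c d e f →
  consistent₆ (a <ᵇ b) (a <ᵇ c) (a <ᵇ d) (a <ᵇ e) (a <ᵇ f) (b <ᵇ c) (b <ᵇ d) (b <ᵇ e) (b <ᵇ f)
              (c <ᵇ d) (c <ᵇ e) (c <ᵇ f) (d <ᵇ e) (d <ᵇ f) (e <ᵇ f) ≡ true
consistent₆-<ᵇ a b c d e f
  rewrite transitiveᵇ-<ᵇ a b c | transitiveᵇ-<ᵇ a b d | transitiveᵇ-<ᵇ a b e | transitiveᵇ-<ᵇ a b f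
        | transitiveᵇ-<ᵇ a c d | transitiveᵇ-<ᵇ a c e | transitiveᵇ-<ᵇ a c f | transitiveᵇ-<ᵇ a d e
        | transitiveᵇ-<ᵇ a d f | transitiveᵇ-<ᵇ a e f | transitiveᵇ-<ᵇ b c d | transitiveᵇ-<ᵇ b c e
        | transitiveᵇ-<ᵇ b c f | transitiveᵇ-<ᵇ b d e | transitiveᵇ-<ᵇ b d f | transitiveᵇ-<ᵇ b e f
        | transitiveᵇ-<ᵇ c d e | transitiveᵇ-<ᵇ c d f | transitiveᵇ-<ᵇ c e f | transitiveᵇ-<ᵇ d e f = refl

crossing-after : ∀ a b c → a ≢ b →
  crossing a b (suc b) c ≡ (((a <ᵇ b) xor true) xor ((a <ᵇ c) xor (b <ᵇ c)))
crossing-after a b c a≢b rewrite <ᵇ-sucʳ a b a≢b | <ᵇ-true (n<1+n b) = refl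

crossing-before : ∀ b c d → b ≢ c → b ≢ d → c ≢ d →
  crossing (suc c) d (suc b) c ≡ ((not (b <ᵇ c) xor not (b <ᵇ d)) xor (false xor not (c <ᵇ d)))
crossing-before b c d b≢c b≢d c≢d
  rewrite <ᵇ-flip b c b≢c | <ᵇ-sucʳ d b (≢-sym b≢d) | <ᵇ-flip b d b≢d
        | <ᵇ-false (n≤1+n c) | <ᵇ-flip c d c≢d = refl

crossing-shifted : ∀ a b c d → a ≢ c → b ≢ c →
  crossing a b (suc c) d ≡ (((a <ᵇ c) xor (b <ᵇ c)) xor ((a <ᵇ d) xor (b <ᵇ d)))
crossing-shifted a b c d a≢c b≢c rewrite <ᵇ-sucʳ a c a≢c | <ᵇ-sucʳ b c b≢c = refl

-- Chords x = (a , b), y = (b + 1 , c), z = (c + 1 , d), pairwise crossing.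
interior-region-check : Vec Bool 10 → Bool
interior-region-check (c01 ∷ c02 ∷ c03 ∷ c04 ∷ c12 ∷ c13 ∷ c14 ∷ c23 ∷ c24 ∷ c34 ∷ []) =
  consistent₅ c01 c02 c03 c04 c12 c13 c14 c23 c24 c34 ⇒ᵇ
  ((c01 xor true) xor (c02 xor c12)) ⇒ᵇ
  ((not c12 xor not c13) xor (false xor not c23)) ⇒ᵇ
  ((c02 xor c12) xor (c03 xor c13)) ⇒ᵇ
  (((c04 xor c14) xor (c24 xor c34)) == ((c03 xor c13) xor (c23 xor true))) ⇒ᵇ
  (((c14 xor c24) xor (c04 xor c14)) == ((c13 xor c23) xor (c03 xor c13)))

interior-region : ∀ a b c d t →
  a ≢ b → a ≢ c → a ≢ d → b ≢ c → b ≢ d → c ≢ d → t ≢ suc b → t ≢ suc c →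
  crossing a b (suc b) c ≡ true → crossing (suc c) d (suc b) c ≡ true → crossing a b (suc c) d ≡ true →
  (between a b t xor between (suc c) d t) ≡ (between a b (suc d) xor between (suc c) d (suc d)) →
  (between (suc b) c t xor between a b t) ≡ (between (suc b) c (suc d) xor between a b (suc d))
interior-region a b c d t a≢b a≢c a≢d b≢c b≢d c≢d t≢b+1 t≢c+1 x⋈y z⋈y x⋈z same =
  trans lhs (trans (==-sound
    (⇒ᵇ-elim (⇒ᵇ-elim (⇒ᵇ-elim (⇒ᵇ-elim (⇒ᵇ-elim
      (allBits-sound 10 interior-region-check refl
        ((a <ᵇ b) ∷ (a <ᵇ c) ∷ (a <ᵇ d) ∷ (a <ᵇ t) ∷ (b <ᵇ c) ∷ (b <ᵇ d) ∷ (b <ᵇ t) ∷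
         (c <ᵇ d) ∷ (c <ᵇ t) ∷ (d <ᵇ t) ∷ []))
      (consistent₅-<ᵇ a b c d t))
      (trans (sym (crossing-after a b c a≢b)) x⋈y))
      (trans (sym (crossing-before b c d b≢c b≢d c≢d)) z⋈y))
      (trans (sym (crossing-shifted a b c d a≢c b≢c)) x⋈z))
      (==-complete (trans (sym same-t) (trans same same-d)))))
    (sym rhs))
  where
  same-t : (between a b t xor between (suc c) d t) ≡ (((a <ᵇ t) xor (b <ᵇ t)) xor ((c <ᵇ t) xor (d <ᵇ t)))
  same-t rewrite <ᵇ-sucˡ c t t≢c+1 = refl
  same-d : (between a b (suc d) xor between (suc c) d (suc d)) ≡
           (((a <ᵇ d) xor (b <ᵇ d)) xor ((c <ᵇ d) xor true))
  same-d rewrite <ᵇ-sucʳ a d a≢d | <ᵇ-sucʳ b d b≢d | <ᵇ-true (n<1+n d) = refl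
  lhs : (between (suc b) c t xor between a b t) ≡ (((b <ᵇ t) xor (c <ᵇ t)) xor ((a <ᵇ t) xor (b <ᵇ t)))
  lhs rewrite <ᵇ-sucˡ b t t≢b+1 = refl
  rhs : (between (suc b) c (suc d) xor between a b (suc d)) ≡
        (((b <ᵇ d) xor (c <ᵇ d)) xor ((a <ᵇ d) xor (b <ᵇ d)))
  rhs rewrite <ᵇ-sucʳ c d c≢d | <ᵇ-sucʳ a d a≢d | <ᵇ-sucʳ b d b≢d = refl

interior-bridge-check : Vec Bool 6 → Bool
interior-bridge-check (c01 ∷ c02 ∷ c03 ∷ c12 ∷ c13 ∷ c23 ∷ []) =
  consistent₄ c01 c02 c03 c12 c13 c23 ⇒ᵇ
  ((c01 xor true) xor (c02 xor c12)) ⇒ᵇ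
  ((not c12 xor not c13) xor (false xor not c23)) ⇒ᵇ
  ((c02 xor c12) xor (c03 xor c13)) ⇒ᵇ
  (((false xor not c01) xor (not c02 xor not c03)) == ((c03 xor c13) xor (c23 xor true)))

-- The same chords with a = g + 1, evaluated at the point g just before x.
interior-bridge : ∀ g b c d →
  suc g ≢ b → suc g ≢ c → suc g ≢ d → b ≢ c → b ≢ d → c ≢ d → b ≢ g → c ≢ g → d ≢ g → g ≢ suc c →
  crossing (suc g) b (suc b) c ≡ true → crossing (suc c) d (suc b) c ≡ true →
  crossing (suc g) b (suc c) d ≡ true →
  (between (suc g) b g xor between (suc c) d g) ≡ (between (suc g) b (suc d) xor between (suc c) d (suc d))
interior-bridge g b c d a≢b a≢c a≢d b≢c b≢d c≢d b≢g c≢g d≢g g≢c+1 x⋈y z⋈y x⋈z =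
  trans at-g (trans (==-sound
    (⇒ᵇ-elim (⇒ᵇ-elim (⇒ᵇ-elim (⇒ᵇ-elim
      (allBits-sound 6 interior-bridge-check refl
        ((a <ᵇ b) ∷ (a <ᵇ c) ∷ (a <ᵇ d) ∷ (b <ᵇ c) ∷ (b <ᵇ d) ∷ (c <ᵇ d) ∷ []))
      (consistent₄-<ᵇ a b c d))
      (trans (sym (crossing-after a b c a≢b)) x⋈y))
      (trans (sym (crossing-before b c d b≢c b≢d c≢d)) z⋈y))
      (trans (sym (crossing-shifted a b c d a≢c b≢c)) x⋈z)))
    (sym at-d))
  where
  a = suc g
  at-g : (between a b g xor between (suc c) d g) ≡
         ((false xor not (a <ᵇ b)) xor (not (a <ᵇ c) xor not (a <ᵇ d)))
  at-g rewrite <ᵇ-false (n≤1+n g) | <ᵇ-sucˡ c g g≢c+1 | sym (<ᵇ-sucʳ b g b≢g)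
             | sym (<ᵇ-sucʳ c g c≢g) | sym (<ᵇ-sucʳ d g d≢g)
             | <ᵇ-flip a b a≢b | <ᵇ-flip a c a≢c | <ᵇ-flip a d a≢d = refl
  at-d : (between a b (suc d) xor between (suc c) d (suc d)) ≡
         (((a <ᵇ d) xor (b <ᵇ d)) xor ((c <ᵇ d) xor true))
  at-d rewrite <ᵇ-sucʳ a d a≢d | <ᵇ-sucʳ b d b≢d | <ᵇ-true (n<1+n d) = refl

first-region-check : Vec Bool 15 → Bool
first-region-check
  (c01 ∷ c02 ∷ c03 ∷ c04 ∷ c05 ∷ c12 ∷ c13 ∷ c14 ∷ c15 ∷ c23 ∷ c24 ∷ c25 ∷ c34 ∷ c35 ∷ c45 ∷ []) =
  consistent₆ c01 c02 c03 c04 c05 c12 c13 c14 c15 c23 c24 c25 c34 c35 c45 ⇒ᵇ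
  ((not c01 xor not c02) xor (false xor not c12)) ⇒ᵇ
  ((c13 xor c23) xor (c14 xor c24)) ⇒ᵇ
  ((not c03 xor not c04) xor (not c13 xor not c14)) ⇒ᵇ
  (((c15 xor c25) xor (c35 xor c45)) == ((c12 xor true) xor (not c23 xor not c24))) ⇒ᵇ
  (((c05 xor c15) xor (c15 xor c25)) == ((c02 xor c12) xor (c12 xor true)))

-- Chords y = (a , b), z = (b + 1 , c) and x = (d , e), pairwise crossing.
first-region : ∀ a b c d e t →
  a ≢ suc b → a ≢ b → a ≢ c → b ≢ c → d ≢ suc b → e ≢ suc b → a ≢ d → a ≢ e → b ≢ d → b ≢ e →
  c ≢ d → c ≢ e → t ≢ suc b →
  crossing (suc b) c a b ≡ true → crossing (suc b) c d e ≡ true → crossing d e a b ≡ true →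
  (between (suc b) c t xor between d e t) ≡ (between (suc b) c (suc c) xor between d e (suc c)) →
  (between a b t xor between (suc b) c t) ≡ (between a b (suc c) xor between (suc b) c (suc c))
first-region a b c d e t a≢b+1 a≢b a≢c b≢c d≢b+1 e≢b+1 a≢d a≢e b≢d b≢e c≢d c≢e t≢b+1
  z⋈y z⋈x x⋈y same =
  trans lhs (trans (==-sound
    (⇒ᵇ-elim (⇒ᵇ-elim (⇒ᵇ-elim (⇒ᵇ-elim (⇒ᵇ-elim
      (allBits-sound 15 first-region-check refl
        ((a <ᵇ b) ∷ (a <ᵇ c) ∷ (a <ᵇ d) ∷ (a <ᵇ e) ∷ (a <ᵇ t) ∷ (b <ᵇ c) ∷ (b <ᵇ d) ∷ (b <ᵇ e) ∷
         (b <ᵇ t) ∷ (c <ᵇ d) ∷ (c <ᵇ e) ∷ (c <ᵇ t) ∷ (d <ᵇ e) ∷ (d <ᵇ t) ∷ (e <ᵇ t) ∷ []))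
      (consistent₆-<ᵇ a b c d e t))
      (trans (sym z⋈y′) z⋈y)) (trans (sym z⋈x′) z⋈x)) (trans (sym x⋈y′) x⋈y))
      (==-complete (trans (sym same-t) (trans same same-c)))))
    (sym rhs))
  where
  z⋈y′ : crossing (suc b) c a b ≡ ((not (a <ᵇ b) xor not (a <ᵇ c)) xor (false xor not (b <ᵇ c)))
  z⋈y′ rewrite <ᵇ-sucˡ b a a≢b+1 | <ᵇ-flip a b a≢b | <ᵇ-flip a c a≢c
             | <ᵇ-false (n≤1+n b) | <ᵇ-flip b c b≢c = refl
  z⋈x′ : crossing (suc b) c d e ≡ (((b <ᵇ d) xor (c <ᵇ d)) xor ((b <ᵇ e) xor (c <ᵇ e)))
  z⋈x′ rewrite <ᵇ-sucˡ b d d≢b+1 | <ᵇ-sucˡ b e e≢b+1 = refl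
  x⋈y′ : crossing d e a b ≡ ((not (a <ᵇ d) xor not (a <ᵇ e)) xor (not (b <ᵇ d) xor not (b <ᵇ e)))
  x⋈y′ rewrite <ᵇ-flip a d a≢d | <ᵇ-flip a e a≢e | <ᵇ-flip b d b≢d | <ᵇ-flip b e b≢e = refl
  same-t : (between (suc b) c t xor between d e t) ≡ (((b <ᵇ t) xor (c <ᵇ t)) xor ((d <ᵇ t) xor (e <ᵇ t)))
  same-t rewrite <ᵇ-sucˡ b t t≢b+1 = refl
  same-c : (between (suc b) c (suc c) xor between d e (suc c)) ≡
           (((b <ᵇ c) xor true) xor (not (c <ᵇ d) xor not (c <ᵇ e)))
  same-c rewrite <ᵇ-true (n<1+n c) | <ᵇ-sucʳ d c (≢-sym c≢d) | <ᵇ-sucʳ e c (≢-sym c≢e)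
               | <ᵇ-flip c d c≢d | <ᵇ-flip c e c≢e = refl
  lhs : (between a b t xor between (suc b) c t) ≡ (((a <ᵇ t) xor (b <ᵇ t)) xor ((b <ᵇ t) xor (c <ᵇ t)))
  lhs rewrite <ᵇ-sucˡ b t t≢b+1 = refl
  rhs : (between a b (suc c) xor between (suc b) c (suc c)) ≡
        (((a <ᵇ c) xor (b <ᵇ c)) xor ((b <ᵇ c) xor true))
  rhs rewrite <ᵇ-sucʳ a c a≢c | <ᵇ-sucʳ b c b≢c | <ᵇ-true (n<1+n c) = refl

last-region-check : Vec Bool 15 → Bool
last-region-check
  (c01 ∷ c02 ∷ c03 ∷ c04 ∷ c05 ∷ c12 ∷ c13 ∷ c14 ∷ c15 ∷ c23 ∷ c24 ∷ c25 ∷ c34 ∷ c35 ∷ c45 ∷ []) =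
  consistent₆ c01 c02 c03 c04 c05 c12 c13 c14 c15 c23 c24 c25 c34 c35 c45 ⇒ᵇ
  ((c01 xor true) xor (c02 xor c12)) ⇒ᵇ
  ((c03 xor c13) xor (c04 xor c14)) ⇒ᵇ
  ((not c13 xor not c14) xor (not c23 xor not c24)) ⇒ᵇ
  (((c05 xor c15) xor (c35 xor c45)) == ((c04 xor c14) xor (c34 xor true))) ⇒ᵇ
  (((c15 xor c25) xor (c05 xor c15)) == ((c14 xor c24) xor (c04 xor c14)))

-- Chords x = (a , b), y = (b + 1 , c) and z = (d , e), pairwise crossing.
last-region : ∀ a b c d e t →
  a ≢ b → b ≢ d → b ≢ e → c ≢ d → c ≢ e → a ≢ e → d ≢ e → t ≢ suc b →
  crossing a b (suc b) c ≡ true → crossing a b d e ≡ true → crossing d e (suc b) c ≡ true →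
  (between a b t xor between d e t) ≡ (between a b (suc e) xor between d e (suc e)) →
  (between (suc b) c t xor between a b t) ≡ (between (suc b) c (suc e) xor between a b (suc e))
last-region a b c d e t a≢b b≢d b≢e c≢d c≢e a≢e d≢e t≢b+1 x⋈y x⋈z z⋈y same =
  trans lhs (trans (==-sound
    (⇒ᵇ-elim (⇒ᵇ-elim (⇒ᵇ-elim (⇒ᵇ-elim (⇒ᵇ-elim
      (allBits-sound 15 last-region-check refl
        ((a <ᵇ b) ∷ (a <ᵇ c) ∷ (a <ᵇ d) ∷ (a <ᵇ e) ∷ (a <ᵇ t) ∷ (b <ᵇ c) ∷ (b <ᵇ d) ∷ (b <ᵇ e) ∷
         (b <ᵇ t) ∷ (c <ᵇ d) ∷ (c <ᵇ e) ∷ (c <ᵇ t) ∷ (d <ᵇ e) ∷ (d <ᵇ t) ∷ (e <ᵇ t) ∷ []))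
      (consistent₆-<ᵇ a b c d e t))
      (trans (sym (crossing-after a b c a≢b)) x⋈y)) x⋈z) (trans (sym z⋈y′) z⋈y))
      (==-complete (trans same same-e))))
    (sym rhs))
  where
  z⋈y′ : crossing d e (suc b) c ≡ ((not (b <ᵇ d) xor not (b <ᵇ e)) xor (not (c <ᵇ d) xor not (c <ᵇ e)))
  z⋈y′ rewrite <ᵇ-sucʳ d b (≢-sym b≢d) | <ᵇ-sucʳ e b (≢-sym b≢e) | <ᵇ-flip b d b≢d | <ᵇ-flip b e b≢e
             | <ᵇ-flip c d c≢d | <ᵇ-flip c e c≢e = refl
  same-e : (between a b (suc e) xor between d e (suc e)) ≡ (((a <ᵇ e) xor (b <ᵇ e)) xor ((d <ᵇ e) xor true))
  same-e rewrite <ᵇ-sucʳ a e a≢e | <ᵇ-sucʳ b e b≢e | <ᵇ-sucʳ d e d≢e | <ᵇ-true (n<1+n e) = refl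
  lhs : (between (suc b) c t xor between a b t) ≡ (((b <ᵇ t) xor (c <ᵇ t)) xor ((a <ᵇ t) xor (b <ᵇ t)))
  lhs rewrite <ᵇ-sucˡ b t t≢b+1 = refl
  rhs : (between (suc b) c (suc e) xor between a b (suc e)) ≡
        (((b <ᵇ e) xor (c <ᵇ e)) xor ((a <ᵇ e) xor (b <ᵇ e)))
  rhs rewrite <ᵇ-sucʳ c e c≢e | <ᵇ-sucʳ a e a≢e | <ᵇ-sucʳ b e b≢e = refl

xor-exchange : ∀ a b c d → (a xor b) ≡ (c xor d) → (a xor c) ≡ (b xor d)
xor-exchange true  true  true  true  _ = refl
xor-exchange true  true  false false _ = refl
xor-exchange true  false true  false _ = refl
xor-exchange true  false false true  _ = refl
xor-exchange false true  true  false _ = refl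
xor-exchange false true  false true  _ = refl
xor-exchange false false true  true  _ = refl
xor-exchange false false false false _ = refl
xor-exchange true  true  true  false ()
xor-exchange true  true  false true  ()
xor-exchange true  false true  true  ()
xor-exchange true  false false false ()
xor-exchange false true  true  true  ()
xor-exchange false true  false false ()
xor-exchange false false true  false ()
xor-exchange false false false true  ()

constant-on : ∀ {A : Set} (f : ℕ → A) {lo hi} → (∀ q → lo ≤ q → q < hi → f q ≡ f (suc q)) →
  ∀ q → lo ≤ q → q ≤ hi → f q ≡ f lo
constant-on f step zero lo≤0 _ = cong f (sym (n≤0⇒n≡0 lo≤0))
constant-on f step (suc q) lo≤q+1 q+1≤hi with m≤n⇒m<n∨m≡n lo≤q+1
... | inj₂ refl = refl
... | inj₁ lo<q+1 =
  trans (sym (step q (≤-pred lo<q+1) q+1≤hi))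
        (constant-on f step q (≤-pred lo<q+1) (≤-trans (n≤1+n q) q+1≤hi))

module MiddlePointer (m : ℕ) (κ : ℕ → ℕ)
  (κ-injective : ∀ {a b} → 1 ≤ a → a ≤ suc m → 1 ≤ b → b ≤ suc m → κ a ≡ κ b → a ≡ b) where

  open Chords m κ κ-injective

  insideOne : ℕ → ℕ → ℕ → Bool
  insideOne a b t = inside a t xor inside b t

  insideOne-start≡end : ∀ {a b q} → a crosses q ≡ true → b crosses q ≡ true →
    insideOne a b (start q) ≡ insideOne a b (end q)
  insideOne-start≡end {a} {b} {q} a⋈q b⋈q =
    xor-exchange (inside a (start q)) (inside a (end q)) (inside b (start q)) (inside b (end q))
      (trans a⋈q (sym b⋈q))

  insideOne-constant : ∀ {a b lo hi} → IsPointer a → IsPointer b → Universal a → Universal b →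
    1 ≤ lo → hi ≤ m → (∀ q → lo ≤ q → q < hi → q ≢ a × q ≢ b) →
    ∀ q → lo ≤ q → q ≤ hi → insideOne a b (start q) ≡ insideOne a b (start lo)
  insideOne-constant {a} {b} {lo} (_ , a≤m) (_ , b≤m) Ua Ub 1≤lo hi≤m avoids =
    constant-on (λ q → insideOne a b (start q)) step
    where
    step : ∀ q → lo ≤ q → _ → insideOne a b (start q) ≡ insideOne a b (start (suc q))
    step q lo≤q q<hi with avoids q lo≤q q<hi
    ... | q≢a , q≢b = trans (insideOne-start≡end (Ua q Pq q≢a) (Ub q Pq q≢b))
      (sym (cong₂ _xor_ (between-suc (start≢end a q) (end-injective a≤m q≤m (≢-sym q≢a)))
                        (between-suc (start≢end b q) (end-injective b≤m q≤m (≢-sym q≢b)))))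
      where
      q≤m = ≤-trans (<⇒≤ q<hi) hi≤m
      Pq = ≤-trans 1≤lo lo≤q , q≤m

  universal-by-region : ∀ {a b y} c d → IsPointer a → IsPointer b → IsPointer y →
    a ≢ y → b ≢ y → Universal a → Universal b →
    (∀ t → t ≢ start a → t ≢ start b → t ≢ start y → insideOne a b t ≡ c →
      (inside y t xor inside a t) ≡ d) →
    (∀ q → IsPointer q → q ≢ a → q ≢ b → q ≢ y → insideOne a b (start q) ≡ c) →
    Universal y
  universal-by-region {a} {b} {y} c d Pa Pb Py a≢y b≢y Ua Ub region constant q Pq q≢y
    with q ≟ a | q ≟ b
  ... | yes refl | _ = crosses-sym Pa Py a≢y (Ua y Py (≢-sym a≢y))
  ... | no _ | yes refl = crosses-sym Pb Py b≢y (Ub y Py (≢-sym b≢y))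
  ... | no q≢a | no q≢b =
    trans (xor-exchange (inside y (start q)) (inside a (start q)) (inside y (end q)) (inside a (end q))
            (trans at-start (sym at-end)))
          (Ua q Pq q≢a)
    where
    at-start = region (start q) (start-injective Pq Pa q≢a) (start-injective Pq Pb q≢b)
                 (start-injective Pq Py q≢y) (constant q Pq q≢a q≢b q≢y)
    at-end = region (end q) (≢-sym (start≢end a q)) (≢-sym (start≢end b q)) (≢-sym (start≢end y q))
               (trans (sym (insideOne-start≡end (Ua q Pq q≢a) (Ub q Pq q≢b))) (constant q Pq q≢a q≢b q≢y))

  universal-between : ∀ i → suc (suc (suc i)) ≤ m →
    Universal (suc i) → Universal (suc (suc (suc i))) → Universal (suc (suc i))
  universal-between i z≤m Ux Uz = universal-by-region c d Px Pz Py x≢y (≢-sym y≢z) Ux Uz region constant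
    where
    x = suc i
    y = suc x
    z = suc y
    y≤m = ≤-trans (n≤1+n y) z≤m
    x≤m = ≤-trans (n≤1+n x) y≤m
    i≤m = ≤-trans (n≤1+n i) x≤m
    Px = s≤s z≤n , x≤m
    Py = s≤s z≤n , y≤m
    Pz = s≤s z≤n , z≤m
    x≢y : x ≢ y
    x≢y = <⇒≢ ≤-refl
    y≢z : y ≢ z
    y≢z = <⇒≢ ≤-refl
    x≢z : x ≢ z
    x≢z = <⇒≢ (n≤1+n y)
    i≤z = ≤-trans (n≤1+n i) (≤-trans (n≤1+n x) (n≤1+n y))
    i≢x : i ≢ x
    i≢x = <⇒≢ ≤-refl
    i≢y : i ≢ y
    i≢y = <⇒≢ (n≤1+n x)
    i≢z : i ≢ z
    i≢z = <⇒≢ (≤-trans (n≤1+n x) (n≤1+n y))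
    x⋈y = Ux y Py (≢-sym x≢y)
    z⋈y = Uz y Py y≢z
    x⋈z = Ux z Pz (≢-sym x≢z)
    c = insideOne x z (start (suc z))
    d = inside y (start (suc z)) xor inside x (start (suc z))

    region : ∀ t → t ≢ start x → t ≢ start z → t ≢ start y → insideOne x z t ≡ c →
      (inside y t xor inside x t) ≡ d
    region t _ t≢z t≢y = interior-region (start x) (end x) (end y) (end z) t
      (start≢end x x) (start≢end x y) (start≢end x z)
      (end-injective x≤m y≤m x≢y) (end-injective x≤m z≤m x≢z) (end-injective y≤m z≤m y≢z)
      t≢y t≢z x⋈y z⋈y x⋈z

    before-x : insideOne x z (end i) ≡ c
    before-x = interior-bridge (end i) (end x) (end y) (end z)
      (start≢end x x) (start≢end x y) (start≢end x z)
      (end-injective x≤m y≤m x≢y) (end-injective x≤m z≤m x≢z) (end-injective y≤m z≤m y≢z)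
      (end-injective x≤m i≤m (≢-sym i≢x)) (end-injective y≤m i≤m (≢-sym i≢y))
      (end-injective z≤m i≤m (≢-sym i≢z))
      (≢-sym (start≢end z i)) x⋈y z⋈y x⋈z

    constant : ∀ q → IsPointer q → q ≢ x → q ≢ z → q ≢ y → insideOne x z (start q) ≡ c
    constant q Pq@(1≤q , q≤m) q≢x q≢z q≢y with <-cmp q x
    ... | tri≈ _ q≡x _ = ⊥-elim (q≢x q≡x)
    ... | tri< q<x _ _ = begin
      insideOne x z (start q) ≡⟨ insideOne-constant Px Pz Ux Uz 1≤q i≤m below i q≤i ≤-refl ⟨
      insideOne x z (start i) ≡⟨ insideOne-start≡end (Ux i Pi i≢x) (Uz i Pi i≢z) ⟩
      insideOne x z (end i)   ≡⟨ before-x ⟩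
      c                       ∎
      where
      open ≡-Reasoning
      q≤i = ≤-pred q<x
      Pi = ≤-trans 1≤q q≤i , i≤m
      below : ∀ q′ → q ≤ q′ → q′ < i → q′ ≢ x × q′ ≢ z
      below q′ _ q′<i = <⇒≢ (≤-trans q′<i (n≤1+n i)) , <⇒≢ (≤-trans q′<i i≤z)
    ... | tri> _ _ x<q = insideOne-constant Px Pz Ux Uz (s≤s z≤n) ≤-refl above q z<q q≤m
      where
      z<q : suc z ≤ q
      z<q = ≤∧≢⇒< (≤∧≢⇒< x<q (≢-sym q≢y)) (≢-sym q≢z)
      above : ∀ q′ → suc z ≤ q′ → q′ < m → q′ ≢ x × q′ ≢ z
      above q′ z<q′ _ = ≢-sym (<⇒≢ (≤-trans (n≤1+n y) (≤-trans (n≤1+n z) z<q′)))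
                      , ≢-sym (<⇒≢ z<q′)

  universal-first : 3 ≤ m → Universal m → Universal 2 → Universal 1
  universal-first 3≤m Ux Uz = universal-by-region c d Pz Px Py (λ ()) (≢-sym 1≢m) Uz Ux region constant
    where
    1≤m = ≤-trans (s≤s z≤n) 3≤m
    2≤m = ≤-trans (s≤s (s≤s z≤n)) 3≤m
    Px = 1≤m , ≤-refl
    Py = ≤-refl , 1≤m
    Pz = s≤s z≤n , 2≤m
    1≢m : 1 ≢ m
    1≢m = <⇒≢ 2≤m
    2≢m : 2 ≢ m
    2≢m = <⇒≢ 3≤m
    c = insideOne 2 m (start 3)
    d = inside 1 (start 3) xor inside 2 (start 3)

    region : ∀ t → t ≢ start 2 → t ≢ start m → t ≢ start 1 → insideOne 2 m t ≡ c →
      (inside 1 t xor inside 2 t) ≡ d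
    region t t≢2 _ _ = first-region (start 1) (end 1) (end 2) (start m) (end m) t
      (start-injective Py Pz (λ ())) (start≢end 1 1) (start≢end 1 2) (end-injective 1≤m 2≤m (λ ()))
      (start-injective Px Pz (≢-sym 2≢m)) (≢-sym (start≢end 2 m)) (start-injective Py Px 1≢m)
      (start≢end 1 m)
      (≢-sym (start≢end m 1)) (end-injective 1≤m ≤-refl 1≢m) (≢-sym (start≢end m 2))
      (end-injective 2≤m ≤-refl 2≢m) t≢2
      (Uz 1 Py (λ ())) (Uz m Px (≢-sym 2≢m)) (Ux 1 Py 1≢m)

    constant : ∀ q → IsPointer q → q ≢ 2 → q ≢ m → q ≢ 1 → insideOne 2 m (start q) ≡ c
    constant q (1≤q , q≤m) q≢2 q≢m q≢1 =
      insideOne-constant Pz Px Uz Ux (s≤s z≤n) pred[n]≤n inner q 3≤q (<⇒≤pred (≤∧≢⇒< q≤m q≢m))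
      where
      3≤q = ≤∧≢⇒< (≤∧≢⇒< 1≤q (≢-sym q≢1)) (≢-sym q≢2)
      inner : ∀ q′ → 3 ≤ q′ → q′ < pred m → q′ ≢ 2 × q′ ≢ m
      inner q′ 3≤q′ q′<m-1 = ≢-sym (<⇒≢ 3≤q′) , <⇒≢ (≤-trans q′<m-1 pred[n]≤n)

  universal-last : ∀ w → 2 ≤ w → suc w ≡ m → Universal w → Universal 1 → Universal (suc w)
  universal-last w 2≤w w+1≡m Ux Uz =
    universal-by-region c d Px Pz Py (<⇒≢ ≤-refl) (<⇒≢ (s≤s (≤-trans (s≤s z≤n) 2≤w))) Ux Uz region constant
    where
    y≤m = ≤-reflexive w+1≡m
    w≤m = ≤-trans (n≤1+n w) y≤m
    1≤w = ≤-trans (s≤s z≤n) 2≤w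
    1≤m = ≤-trans 1≤w w≤m
    Px = 1≤w , w≤m
    Py = s≤s z≤n , y≤m
    Pz = ≤-refl , 1≤m
    1≢w : 1 ≢ w
    1≢w = <⇒≢ 2≤w
    1≢y : 1 ≢ suc w
    1≢y = <⇒≢ (s≤s 1≤w)
    c = insideOne w 1 (start 2)
    d = inside (suc w) (start 2) xor inside w (start 2)

    region : ∀ t → t ≢ start w → t ≢ start 1 → t ≢ start (suc w) → insideOne w 1 t ≡ c →
      (inside (suc w) t xor inside w t) ≡ d
    region t _ _ t≢y = last-region (start w) (end w) (end (suc w)) (start 1) (end 1) t
      (start≢end w w) (≢-sym (start≢end 1 w)) (end-injective w≤m 1≤m (≢-sym 1≢w))
      (≢-sym (start≢end 1 (suc w))) (end-injective y≤m 1≤m (≢-sym 1≢y)) (start≢end w 1) (start≢end 1 1)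
      t≢y (Ux (suc w) Py (≢-sym (<⇒≢ ≤-refl))) (Ux 1 Pz 1≢w) (Uz (suc w) Py (≢-sym 1≢y))

    constant : ∀ q → IsPointer q → q ≢ w → q ≢ 1 → q ≢ suc w → insideOne w 1 (start q) ≡ c
    constant q (1≤q , q≤m) q≢w q≢1 q≢y =
      insideOne-constant Px Pz Ux Uz (s≤s z≤n) (≤-trans pred[n]≤n w≤m) inner q 2≤q
        (<⇒≤pred (≤∧≢⇒< (≤-pred (≤∧≢⇒< (≤-trans q≤m (≤-reflexive (sym w+1≡m))) q≢y)) q≢w))
      where
      2≤q = ≤∧≢⇒< 1≤q (≢-sym q≢1)
      inner : ∀ q′ → 2 ≤ q′ → q′ < pred w → q′ ≢ w × q′ ≢ 1
      inner q′ 2≤q′ q′<w-1 = <⇒≢ (≤-trans q′<w-1 pred[n]≤n) , ≢-sym (<⇒≢ 2≤q′)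

nextM-cases : ∀ n p → (p ≡ 2 * n ∸ 1 × nextM n p ≡ 1) ⊎ (p ≢ 2 * n ∸ 1 × nextM n p ≡ suc p)
nextM-cases n p with p ≡ᵇ 2 * n ∸ 1 in p≟m
... | true = inj₁ (≡ᵇ-true p≟m , refl)
... | false = inj₂ ((λ p≡m → subst T p≟m (≡⇒≡ᵇ _ _ p≡m)) , refl)

module Contraction (k : ℕ) (π : List ℕ) (π↭ : IsPerm (2 * suc k) π) where

  n = suc k
  m = 2 * n ∸ 1

  open CompatibleCrossing m π π↭
  open MiddlePointer m (position π) (position-injective-on π↭)

  universalM⇒universal : ∀ {p} → 1 ≤ p → UniversalM n π p → Universal p
  universalM⇒universal 1≤p U q Q q≢p = compatible⇒crosses 1≤p (proj₁ Q) (U q Q q≢p)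

  universal⇒universalM : ∀ {p} → IsPointer p → Universal p → UniversalM n π p
  universal⇒universalM P U q Q q≢p = crosses⇒compatible P Q (≢-sym q≢p) (U q Q q≢p)

  universal? : ∀ p → Dec (Universal p)
  universal? p =
    map′ (λ U q (1≤q , q≤m) → U {q} (s≤s q≤m) 1≤q) (λ U {q} q<m+1 1≤q → U q (1≤q , ≤-pred q<m+1))
      (allUpTo? (λ q → (1 ≤? q) →-dec ¬? (q ≟ p) →-dec (p crosses q Bool.≟ true)) (suc m))

  prevM-positive : ∀ {p} → IsPointer p → 1 ≤ prevM n p
  prevM-positive {suc zero} (_ , 1≤m) = 1≤m
  prevM-positive {suc (suc _)} _ = s≤s z≤n

  nextM-positive : ∀ p → 1 ≤ nextM n p
  nextM-positive p with nextM-cases n p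
  ... | inj₁ (_ , next≡1) = subst (1 ≤_) (sym next≡1) (s≤s z≤n)
  ... | inj₂ (_ , next≡p+1) = subst (1 ≤_) (sym next≡p+1) (s≤s z≤n)

  universal-middle : 3 ≤ m → ∀ {p} → IsPointer p →
    Universal (prevM n p) → Universal (nextM n p) → Universal p
  universal-middle 3≤m {suc zero} _ U-prev U-next with nextM-cases n 1
  ... | inj₁ (1≡m , _) = ⊥-elim (<⇒≢ (≤-trans (s≤s (s≤s z≤n)) 3≤m) 1≡m)
  ... | inj₂ (_ , next≡2) = universal-first 3≤m U-prev (subst Universal next≡2 U-next)
  universal-middle 3≤m {suc (suc i)} (_ , p≤m) U-prev U-next with nextM-cases n (suc (suc i))
  ... | inj₁ (p≡m , next≡1) =
    universal-last (suc i) (≤-pred (subst (3 ≤_) (sym p≡m) 3≤m)) p≡m U-prev (subst Universal next≡1 U-next)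
  ... | inj₂ (p≢m , next≡p+1) =
    universal-between i (≤∧≢⇒< p≤m p≢m) U-prev (subst Universal next≡p+1 U-next)

  neighbour-not-universal : 2 ≤ n → ∀ {p} → IsPointer p → ¬ UniversalM n π p →
    ¬ UniversalM n π (prevM n p) ⊎ ¬ UniversalM n π (nextM n p)
  neighbour-not-universal 2≤n {p} P ¬Up with universal? (prevM n p) | universal? (nextM n p)
  ... | no ¬U-prev | _ = inj₁ (¬U-prev ∘ universalM⇒universal (prevM-positive P))
  ... | yes _ | no ¬U-next = inj₂ (¬U-next ∘ universalM⇒universal (nextM-positive p))
  ... | yes U-prev | yes U-next =
    contradiction (universal⇒universalM P (universal-middle 3≤m P U-prev U-next)) ¬Up
    where
    3≤m : 3 ≤ m
    3≤m = ∸-monoˡ-≤ 1 (*-monoʳ-≤ 2 2≤n)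

lemma4p16 : (n : ℕ) → 2 ≤ n → (π : List ℕ) → IsPerm (2 * n) π → MaxSP n π →
            (p : ℕ) → IsPointerM n p → ¬ UniversalM n π p →
            ¬ UniversalM n π (prevM n p) ⊎ ¬ UniversalM n π (nextM n p)
lemma4p16 (suc k) 2≤n π π↭ _ p = Contraction.neighbour-not-universal k π π↭ 2≤n
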